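{- Let $H$ be a non-empty non-crossing ordered perfect matching. Then $g_H(n)=\Omega(n^{1/d})$, where $d=\mathrm{depth}(H)$.
   Context: An ordered graph is a graph with a total order on its vertices. For a graph $G$ with a Hamiltonian path $P=v_1,\dots,v_n$, $(G,P)$ contains the ordered graph $H$ (order $u_1,\dots,u_k$) as a pattern if there exist $1\le a_1<\dots<a_k\le n$ such that every edge $u_iu_j$ of $H$ maps to an edge $v_{a_i}v_{a_j}$ of $G-E(P)$; otherwise $(G,P)$ avoids $H$. $g_H(n)$ is the maximum integer $t$ such that for every graph $G$ with a Hamiltonian path $P$ on $n$ vertices, if $(G,P)$ avoids $H$ then $G$ contains an induced path on at least $t$ vertices. An ordered perfect matching is an ordered 1-regular graph; it is non-crossing if there are no $a<b<c<d$ with edges $u_au_c$ and $u_bu_d$. Depth of a non-crossing ordered perfect matching $C=u_1,\dots,u_k$: if $C$ is empty, $\mathrm{depth}(C)=0$; otherwise let $u_1u_i$ be the edge at $u_1$, let $A$ be the ordered subgraph induced by $u_2,\dots,u_{i-1}$ and $B$ the ordered subgraph induced by $u_{i+1},\dots,u_k$ (both non-crossing ordered perfect matchings), and set $\mathrm{depth}(C)=\max\{\mathrm{depth}(A)+1,\mathrm{depth}(B)\}$. -}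

module Defs where

open import Data.Nat using (ℕ; zero; suc; _+_; _*_; _∸_; _^_; _≤_; _<_; _≡ᵇ_; _≤ᵇ_)
open import Data.Fin using (Fin; toℕ)
open import Data.Bool using (Bool; true; false; _∧_; _∨_)
open import Data.Product using (Σ; ∃; ∃-syntax; _×_; _,_)
open import Relation.Binary.PropositionalEquality using (_≡_; _≢_)
open import Relation.Nullary using (¬_)
open import Function.Definitions using (Injective)
open import Function.Base using (_∘_)

-- An *ordered* graph on k vertices is the
-- same data on Fin k, ordered by the natural order of Fin k.
record Graph (n : ℕ) : Set where
  field
    adj   : Fin n → Fin n → Bool
    sym   : ∀ u v → adj u v ≡ adj v u
    irref : ∀ v → adj v v ≡ false
open Graph public

OrderedGraph : ℕ → Set
OrderedGraph = Graph

Edge : ∀ {n} → Graph n → Fin n → Fin n → Set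
Edge G u v = adj G u v ≡ true

record HamPath {n : ℕ} (G : Graph n) : Set where
  field
    at        : Fin n → Fin n
    injective : Injective _≡_ _≡_ at
    edges     : ∀ (i j : Fin n) → suc (toℕ i) ≡ toℕ j → Edge G (at i) (at j)
open HamPath public

Consecutive : ∀ {n} → Fin n → Fin n → Set
Consecutive i j = (suc (toℕ i) ≡ toℕ j) Data.Sum.⊎ (suc (toℕ j) ≡ toℕ i)
  where import Data.Sum

-- The edge between the vertices at positions i and j of P is an edge of
-- G - E(P).  (Since P is injective, the edges of P are exactly the pairs
-- of vertices at consecutive positions.)
EdgeOffPath : ∀ {n} (G : Graph n) (P : HamPath G) → Fin n → Fin n → Set
EdgeOffPath G P i j = Edge G (at P i) (at P j) × ¬ Consecutive i j

StrictlyIncreasing : ∀ {k n} → (Fin k → Fin n) → Set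
StrictlyIncreasing {k} a = ∀ (i j : Fin k) → toℕ i < toℕ j → toℕ (a i) < toℕ (a j)

Contains : ∀ {n k} (G : Graph n) (P : HamPath G) (H : OrderedGraph k) → Set
Contains {n} {k} G P H =
  Σ (Fin k → Fin n) λ a → StrictlyIncreasing a ×
    (∀ (i j : Fin k) → Edge H i j → EdgeOffPath G P (a i) (a j))

Avoids : ∀ {n k} (G : Graph n) (P : HamPath G) (H : OrderedGraph k) → Set
Avoids G P H = ¬ Contains G P H

InducedPath : ∀ {n} (G : Graph n) (t : ℕ) → (Fin t → Fin n) → Set
InducedPath G t w =
  Injective _≡_ _≡_ w ×
  (∀ (i j : Fin t) → (Edge G (w i) (w j) → Consecutive i j) ×
                     (Consecutive i j → Edge G (w i) (w j)))

IsPerfectMatching : ∀ {k} → OrderedGraph k → Set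
IsPerfectMatching {k} H =
  ∀ (u : Fin k) → Σ (Fin k) λ v → Edge H u v × (∀ w → Edge H u w → w ≡ v)

NonCrossing : ∀ {k} → OrderedGraph k → Set
NonCrossing {k} H = ∀ (a b c d : Fin k) →
  toℕ a < toℕ b → toℕ b < toℕ c → toℕ c < toℕ d →
  ¬ (Edge H a c × Edge H b d)

-- Non-crossing perfect matchings as trees following the recursive
-- decomposition used in the definition of depth:
--   node A B  =  u_1 matched to u_i, A on u_2..u_{i-1}, B on u_{i+1}..u_k.
data NCM : Set where
  nil  : NCM
  node : NCM → NCM → NCM

size : NCM → ℕ
size nil        = 0
size (node A B) = 2 + size A + size B

depth : NCM → ℕ
depth nil        = 0
depth (node A B) = Data.Nat._⊔_ (suc (depth A)) (depth B)
  where import Data.Nat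

inRange : ℕ → ℕ → ℕ → Bool
inRange lo hi x = (lo ≤ᵇ x) ∧ (x ≤ᵇ hi)

mAdj : NCM → ℕ → ℕ → Bool
mAdj nil i j = false
mAdj (node A B) i j =
  ((i ≡ᵇ 0) ∧ (j ≡ᵇ suc (size A))) ∨
  ((j ≡ᵇ 0) ∧ (i ≡ᵇ suc (size A))) ∨
  (inRange 1 (size A) i ∧ inRange 1 (size A) j ∧ mAdj A (i ∸ 1) (j ∸ 1)) ∨
  ((2 + size A ≤ᵇ i) ∧ (2 + size A ≤ᵇ j) ∧
     mAdj B (i ∸ (2 + size A)) (j ∸ (2 + size A)))

Describes : ∀ {k} → NCM → OrderedGraph k → Set
Describes {k} M H = (size M ≡ k) × (∀ (u v : Fin k) → adj H u v ≡ mAdj M (toℕ u) (toℕ v))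

-- Index the vertices of G by their positions along P.  An occurrence of the matching node A B
-- (first vertex matched across A, then B) is an edge x y of G − E(P) with an occurrence of A
-- strictly between x and y and an occurrence of B after y.  By induction on the matching, a
-- window of positions avoiding M either contains an induced path on more than τ vertices or has
-- at most size M · (τ + 1) ^ depth M positions: up to the first position p where node A nil
-- occurs, the walk that always jumps to the furthest neighbour is an induced path whose jumps
-- span windows avoiding A, and beyond p the window avoids B.  Raising τ until the first
-- alternative fails gives an induced path on t vertices with n ≤ size M · (t + 1) ^ depth M,
-- and t ≥ 1 once n > size M.

module Submission where

open import Defs
open import Data.Nat
open import Data.Nat.Properties
open import Data.Nat.Solver using (module +-*-Solver)
open import Data.Bool using (Bool; true; false; T; _∧_)
open import Data.Bool.Properties using (T-∧; T-∨; T-≡) renaming (_≟_ to _≟ᵇ_)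
open import Data.Fin using (Fin; toℕ; fromℕ<)
open import Data.Fin.Properties using (toℕ<n; toℕ-fromℕ<; fromℕ<-toℕ; toℕ-injective)
open import Data.Product using (Σ; _×_; _,_; proj₁; proj₂)
open import Data.Sum using (_⊎_; inj₁; inj₂)
open import Data.Empty using (⊥-elim)
open import Function.Base using (_∘_)
open import Function.Bundles using (module Equivalence)
open import Relation.Nullary using (¬_; Dec; yes; no; contradiction)
open import Relation.Nullary.Decidable using (map′; _×-dec_)
open import Relation.Unary using (Decidable)
open import Relation.Binary.Definitions using (tri<; tri≈; tri>)
open import Relation.Binary.PropositionalEquality
  using (_≡_; refl; trans; cong; cong₂; subst; subst₂) renaming (sym to ≡-sym)

open +-*-Solver using (solve; _:+_; _:*_; _:=_; con)
open Equivalence using (to; from)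

node-budget : ∀ {lo p hi} τ sA sB dA dB →
  p ≤ lo + τ * suc (sA * suc τ ^ dA) → hi ≤ suc p + sB * suc τ ^ dB →
  hi ≤ lo + (2 + sA + sB) * suc τ ^ (suc dA ⊔ dB)
node-budget {lo} {p} {hi} τ sA sB dA dB p≤ hi≤ = begin
  hi                                  ≤⟨ hi≤ ⟩
  suc p + sB * suc τ ^ dB             ≤⟨ +-mono-≤ (s≤s (≤-trans p≤ (+-monoʳ-≤ lo prefix))) (*-monoʳ-≤ sB Y≤Z) ⟩
  1 + (lo + suc sA * Z) + sB * Z      ≤⟨ +-monoˡ-≤ (sB * Z) (+-monoˡ-≤ (lo + suc sA * Z) 1≤Z) ⟩
  Z + (lo + suc sA * Z) + sB * Z      ≡⟨ solve 4 (λ z l a b → z :+ (l :+ (con 1 :+ a) :* z) :+ b :* z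
                                                   := l :+ (con 2 :+ a :+ b) :* z) refl Z lo sA sB ⟩
  lo + (2 + sA + sB) * Z              ∎
  where
    open ≤-Reasoning
    Q = suc τ ^ dA
    Z = suc τ ^ (suc dA ⊔ dB)
    1≤Z : 1 ≤ Z
    1≤Z = m^n>0 (suc τ) (suc dA ⊔ dB)
    Y≤Z : suc τ ^ dB ≤ Z
    Y≤Z = ^-monoʳ-≤ (suc τ) (m≤n⊔m (suc dA) dB)
    prefix : τ * suc (sA * Q) ≤ suc sA * Z
    prefix = begin
      τ * suc (sA * Q)       ≤⟨ *-monoʳ-≤ τ (+-monoˡ-≤ (sA * Q) (m^n>0 (suc τ) dA)) ⟩
      τ * (suc sA * Q)       ≤⟨ *-monoˡ-≤ (suc sA * Q) (n≤1+n τ) ⟩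
      suc τ * (suc sA * Q)   ≡⟨ solve 3 (λ t a q → t :* (a :* q) := a :* (t :* q)) refl (suc τ) (suc sA) Q ⟩
      suc sA * suc τ ^ suc dA ≤⟨ *-monoʳ-≤ (suc sA) (^-monoʳ-≤ (suc τ) (m≤m⊔n (suc dA) dB)) ⟩
      suc sA * Z             ∎

[1+t]^d≤2^d*t^d : ∀ {t} d → 1 ≤ t → suc t ^ d ≤ 2 ^ d * t ^ d
[1+t]^d≤2^d*t^d zero _ = ≤-refl
[1+t]^d≤2^d*t^d {t} (suc d) 1≤t = begin
  suc t * suc t ^ d           ≤⟨ *-mono-≤ (+-monoˡ-≤ t 1≤t) ([1+t]^d≤2^d*t^d d 1≤t) ⟩
  (t + t) * (2 ^ d * t ^ d)   ≡⟨ solve 3 (λ a b c → (a :+ a) :* (b :* c) := (con 2 :* b) :* (a :* c))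
                                        refl t (2 ^ d) (t ^ d) ⟩
  2 ^ suc d * t ^ suc d       ∎
  where open ≤-Reasoning

n≤s*[1+t]^d⇒n≤s*2^d*t^d : ∀ {n s} t d → suc s ≤ n → n ≤ s * suc t ^ d → n ≤ s * 2 ^ d * t ^ d
n≤s*[1+t]^d⇒n≤s*2^d*t^d {s = s} zero d s<n n≤ =
  contradiction (≤-trans n≤ (≤-reflexive (trans (cong (s *_) (^-zeroˡ d)) (*-identityʳ s)))) (<⇒≱ s<n)
n≤s*[1+t]^d⇒n≤s*2^d*t^d {n} {s} t@(suc _) d _ n≤ = begin
  n                      ≤⟨ n≤ ⟩
  s * suc t ^ d          ≤⟨ *-monoʳ-≤ s ([1+t]^d≤2^d*t^d d (s≤s z≤n)) ⟩
  s * (2 ^ d * t ^ d)    ≡⟨ *-assoc s (2 ^ d) (t ^ d) ⟨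
  s * 2 ^ d * t ^ d      ∎
  where open ≤-Reasoning

Consecutiveℕ : ℕ → ℕ → Set
Consecutiveℕ i j = suc i ≡ j ⊎ suc j ≡ i

consecutive-sym : ∀ {i j} → Consecutiveℕ i j → Consecutiveℕ j i
consecutive-sym (inj₁ e) = inj₂ e
consecutive-sym (inj₂ e) = inj₁ e

consecutive-suc : ∀ {i j} → Consecutiveℕ i j → Consecutiveℕ (suc i) (suc j)
consecutive-suc (inj₁ e) = inj₁ (cong suc e)
consecutive-suc (inj₂ e) = inj₂ (cong suc e)

consecutive-pred : ∀ {i j} → Consecutiveℕ (suc i) (suc j) → Consecutiveℕ i j
consecutive-pred (inj₁ e) = inj₁ (suc-injective e)
consecutive-pred (inj₂ e) = inj₂ (suc-injective e)

gap⇒¬consecutive : ∀ {i j} → suc i < j → ¬ Consecutiveℕ i j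
gap⇒¬consecutive i+1<j (inj₁ e) = <-irrefl e i+1<j
gap⇒¬consecutive i+1<j (inj₂ e) = <-asym (≤-trans (n≤1+n _) i+1<j) (≤-reflexive e)

IncreasingBelow : ℕ → (ℕ → ℕ) → Set
IncreasingBelow m f = ∀ i j → i < j → j < m → f i < f j

infixr 5 _◂_
_◂_ : ℕ → (ℕ → ℕ) → ℕ → ℕ
(x ◂ f) zero    = x
(x ◂ f) (suc i) = f i

◂-all : ∀ (P : ℕ → Set) {x f m} → P x → (∀ i → i < m → P (f i)) →
        ∀ i → i < suc m → P ((x ◂ f) i)
◂-all P px pf zero    _         = px
◂-all P px pf (suc i) (s≤s i<m) = pf i i<m

◂-increasing : ∀ {x f m} → (∀ i → i < m → x < f i) → IncreasingBelow m f →
               IncreasingBelow (suc m) (x ◂ f)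
◂-increasing x<f f↑ zero    (suc j) _         (s≤s j<m) = x<f j j<m
◂-increasing x<f f↑ (suc i) (suc j) (s≤s i<j) (s≤s j<m) = f↑ i j i<j j<m

splice : ℕ → (ℕ → ℕ) → ℕ → (ℕ → ℕ) → ℕ → ℕ
splice zero    f y g = y ◂ g
splice (suc s) f y g = f 0 ◂ splice s (f ∘ suc) y g

splice-all : ∀ (P : ℕ → Set) s {f y g m} → (∀ i → i < s → P (f i)) → P y → (∀ k → k < m → P (g k)) →
             ∀ i → i < suc (s + m) → P (splice s f y g i)
splice-all P zero    pf py pg = ◂-all P py pg
splice-all P (suc s) pf py pg = ◂-all P (pf 0 z<s) (splice-all P s (λ i i<s → pf (suc i) (s≤s i<s)) py pg)

splice-increasing : ∀ s {f y g m} → IncreasingBelow s f → (∀ i → i < s → f i < y) →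
                    (∀ k → k < m → y < g k) → IncreasingBelow m g →
                    IncreasingBelow (suc (s + m)) (splice s f y g)
splice-increasing zero    f↑ f<y y<g g↑ = ◂-increasing y<g g↑
splice-increasing (suc s) {f} f↑ f<y y<g g↑ =
  ◂-increasing f₀<rest
    (splice-increasing s (λ i j i<j j<s → f↑ (suc i) (suc j) (s≤s i<j) (s≤s j<s))
                         (λ i i<s → f<y (suc i) (s≤s i<s)) y<g g↑)
  where
    f₀<rest = splice-all (f 0 <_) s (λ i i<s → f↑ 0 (suc i) z<s (s≤s i<s)) (f<y 0 z<s)
                           (λ k k<m → <-trans (f<y 0 z<s) (y<g k k<m))

splice-left : ∀ s {f y g i} → i < s → splice s f y g i ≡ f i
splice-left (suc s) {i = zero}  _         = refl
splice-left (suc s) {i = suc i} (s≤s i<s) = splice-left s i<s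

splice-middle : ∀ s {f y g} → splice s f y g s ≡ y
splice-middle zero    = refl
splice-middle (suc s) = splice-middle s

splice-right : ∀ s {f y g} k → splice s f y g (suc (s + k)) ≡ g k
splice-right zero    k = refl
splice-right (suc s) k = splice-right s k

data MatchingEdge (A B : NCM) : ℕ → ℕ → Set where
  outer  : MatchingEdge A B 0 (suc (size A))
  outer′ : MatchingEdge A B (suc (size A)) 0
  inner  : ∀ {i j} → i < size A → j < size A → T (mAdj A i j) →
           MatchingEdge A B (suc i) (suc j)
  after  : ∀ {i j} → i < size B → j < size B → T (mAdj B i j) →
           MatchingEdge A B (suc (suc (size A + i))) (suc (suc (size A + j)))

innerEdge : ∀ {A B} i j → T (inRange 1 (size A) i ∧ inRange 1 (size A) j ∧ mAdj A (i ∸ 1) (j ∸ 1)) →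
            MatchingEdge A B i j
innerEdge {A} (suc i) (suc j) e =
  inner (<ᵇ⇒< i (size A) i<) (<ᵇ⇒< j (size A) (proj₁ (to T-∧ rest))) (proj₂ (to T-∧ rest))
  where
    i< = proj₁ (to (T-∧ {i <ᵇ size A}) e)
    rest = proj₂ (to (T-∧ {i <ᵇ size A}) e)
innerEdge {A} (suc i) zero e = ⊥-elim (proj₂ (to (T-∧ {i <ᵇ size A}) e))

afterEdge : ∀ {A B} i j → i < size (node A B) → j < size (node A B) →
            T ((2 + size A ≤ᵇ i) ∧ (2 + size A ≤ᵇ j) ∧ mAdj B (i ∸ (2 + size A)) (j ∸ (2 + size A))) →
            MatchingEdge A B i j
afterEdge {A} {B} i j i< j< e =
  subst₂ (MatchingEdge A B) (m+[n∸m]≡n (≤ᵇ⇒≤ _ _ i≥)) (m+[n∸m]≡n (≤ᵇ⇒≤ _ _ j≥))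
    (after (shift i< i≥) (shift j< j≥) (proj₂ (to T-∧ rest)))
  where
    i≥ = proj₁ (to (T-∧ {2 + size A ≤ᵇ i}) e)
    rest = proj₂ (to (T-∧ {2 + size A ≤ᵇ i}) e)
    j≥ = proj₁ (to (T-∧ {2 + size A ≤ᵇ j}) rest)
    shift : ∀ {k} → k < size (node A B) → T (2 + size A ≤ᵇ k) → k ∸ (2 + size A) < size B
    shift k< k≥ = +-cancelˡ-< (2 + size A) _ _
                    (subst (_< size (node A B)) (≡-sym (m+[n∸m]≡n (≤ᵇ⇒≤ _ _ k≥))) k<)

matchingEdge : ∀ {A B} i j → i < size (node A B) → j < size (node A B) →
               T (mAdj (node A B) i j) → MatchingEdge A B i j
matchingEdge {A} i j i< j< e with to T-∨ e
... | inj₁ e₁ with ≡ᵇ⇒≡ i 0 (proj₁ (to T-∧ e₁)) | ≡ᵇ⇒≡ j (suc (size A)) (proj₂ (to T-∧ e₁))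
...   | refl | refl = outer
matchingEdge {A} i j i< j< e | inj₂ e₂ with to T-∨ e₂
... | inj₁ e₃ with ≡ᵇ⇒≡ j 0 (proj₁ (to T-∧ e₃)) | ≡ᵇ⇒≡ i (suc (size A)) (proj₂ (to T-∧ e₃))
...   | refl | refl = outer′
matchingEdge i j i< j< e | inj₂ e₂ | inj₂ e₄ with to T-∨ e₄
... | inj₁ e₅ = innerEdge i j e₅
... | inj₂ e₆ = afterEdge i j i< j< e₆

module _ {P : ℕ → Set} (P? : Decidable P) where

  switchPoint : ∀ {lo} hi → lo ≤ hi → ¬ P lo →
    Σ ℕ λ p → lo ≤ p × p ≤ hi × ¬ P p × (p ≡ hi ⊎ p < hi × P (suc p))
  switchPoint zero z≤n ¬Plo = 0 , z≤n , z≤n , ¬Plo , inj₁ refl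
  switchPoint {lo} (suc h) lo≤hi ¬Plo with m≤n⇒m<n∨m≡n lo≤hi
  ... | inj₂ refl = lo , ≤-refl , ≤-refl , ¬Plo , inj₁ refl
  ... | inj₁ (s≤s lo≤h) with switchPoint h lo≤h ¬Plo
  ...   | p , lo≤p , p≤h , ¬Pp , inj₂ (p<h , Pp+1) =
          p , lo≤p , m≤n⇒m≤1+n p≤h , ¬Pp , inj₂ (m<n⇒m<1+n p<h , Pp+1)
  ...   | p , lo≤p , _ , ¬Pp , inj₁ refl with P? (suc p)
  ...     | yes Pp+1 = p , lo≤p , n≤1+n p , ¬Pp , inj₂ (≤-refl , Pp+1)
  ...     | no ¬Pp+1 = suc p , m≤n⇒m≤1+n lo≤p , ≤-refl , ¬Pp+1 , inj₁ refl

module _ {L : Set} (len : L → ℕ) {S : ℕ → Set} (bound : ℕ) (len≤bound : ∀ l → len l ≤ bound)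
         (long-or-S : ∀ τ → (Σ L λ l → τ < len l) ⊎ S τ)
         (S-mono : ∀ {τ τ′} → τ ≤ τ′ → S τ → S τ′) where

  climb : ∀ fuel τ (l : L) → τ ≤ len l → bound ≤ τ + fuel → Σ L (S ∘ len)
  climb fuel τ l τ≤l _ with long-or-S τ
  ... | inj₂ Sτ = l , S-mono τ≤l Sτ
  climb zero τ l _ bound≤τ | inj₁ (l′ , τ<l′) =
    contradiction (≤-trans (len≤bound l′) (≤-trans bound≤τ (≤-reflexive (+-identityʳ τ)))) (<⇒≱ τ<l′)
  climb (suc fuel) τ l _ bound≤ | inj₁ (l′ , τ<l′) =
    climb fuel (suc τ) l′ τ<l′ (≤-trans bound≤ (≤-reflexive (+-suc τ fuel)))

-- Vertices are named by their positions 0, 1, …, n ∸ 1 along the Hamiltonian path.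
module PositionGraph (n : ℕ) (Ad : ℕ → ℕ → Bool)
  (Ad-sym : ∀ x y → Ad x y ≡ Ad y x)
  (Ad-irrefl : ∀ x → Ad x x ≡ false)
  (Ad-path : ∀ x → suc x < n → Ad x (suc x) ≡ true) where

  OffPathEdge : ℕ → ℕ → Set
  OffPathEdge u v = Ad u v ≡ true × ¬ Consecutiveℕ u v

  record InducedPathIn (lo hi : ℕ) : Set where
    field
      len              : ℕ
      vertex           : ℕ → ℕ
      increasing       : IncreasingBelow len vertex
      inside           : ∀ i → i < len → lo ≤ vertex i × vertex i < hi
      edge⇒consecutive : ∀ i j → i < len → j < len → Ad (vertex i) (vertex j) ≡ true → Consecutiveℕ i j
      consecutive⇒edge : ∀ i j → i < len → j < len → Consecutiveℕ i j → Ad (vertex i) (vertex j) ≡ true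
  open InducedPathIn public using (len; vertex)

  LongPathIn : ℕ → ℕ → ℕ → Set
  LongPathIn τ lo hi = Σ (InducedPathIn lo hi) λ p → τ < len p

  emptyPath : ∀ {lo hi} → InducedPathIn lo hi
  emptyPath = record
    { len = 0 ; vertex = λ _ → 0 ; increasing = λ _ _ _ () ; inside = λ _ ()
    ; edge⇒consecutive = λ _ _ () ; consecutive⇒edge = λ _ _ () }

  singletonPath : ∀ {lo hi} x → lo ≤ x → x < hi → InducedPathIn lo hi
  singletonPath x lo≤x x<hi = record
    { len = 1 ; vertex = λ _ → x
    ; increasing = λ { _ zero () _ ; _ (suc _) _ (s≤s ()) }
    ; inside = λ _ _ → lo≤x , x<hi
    ; edge⇒consecutive = λ { zero zero _ _ xx → contradiction (trans (≡-sym xx) (Ad-irrefl x)) λ ()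
                           ; (suc _) _ (s≤s ()) _ _ ; zero (suc _) _ (s≤s ()) _ }
    ; consecutive⇒edge = λ { zero zero _ _ (inj₁ ()) ; zero zero _ _ (inj₂ ())
                           ; (suc _) _ (s≤s ()) _ _ ; zero (suc _) _ (s≤s ()) _ } }

  widenPath : ∀ {lo hi lo′ hi′} → lo′ ≤ lo → hi ≤ hi′ → InducedPathIn lo hi → InducedPathIn lo′ hi′
  widenPath lo′≤lo hi≤hi′ p = record
    { len = len p ; vertex = vertex p ; increasing = increasing
    ; inside = λ i i< → ≤-trans lo′≤lo (proj₁ (inside i i<)) , <-≤-trans (proj₂ (inside i i<)) hi≤hi′
    ; edge⇒consecutive = edge⇒consecutive ; consecutive⇒edge = consecutive⇒edge }
    where open InducedPathIn p hiding (len; vertex)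

  len≤hi : ∀ {lo hi} (p : InducedPathIn lo hi) → len p ≤ hi
  len≤hi {hi = hi} p = below (len p) ≤-refl
    where
      open InducedPathIn p hiding (len; vertex)
      index≤vertex : ∀ i → i < len p → i ≤ vertex p i
      index≤vertex zero    _   = z≤n
      index≤vertex (suc i) i< =
        ≤-<-trans (index≤vertex i (<-trans (n<1+n i) i<)) (increasing i (suc i) (n<1+n i) i<)
      below : ∀ m → m ≤ len p → m ≤ hi
      below zero    _  = z≤n
      below (suc m) m< = ≤-trans (s≤s (index≤vertex m m<)) (proj₂ (inside m m<))

  prependPath : ∀ {hi} x y (p : InducedPathIn y hi) → 0 < len p → vertex p 0 ≡ y → x < y →
                Ad x y ≡ true → (∀ z → y < z → z < hi → Ad x z ≡ false) → InducedPathIn x hi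
  prependPath {hi} x y p 0<len v₀≡y x<y xy x↛ = record
    { len = suc (len p) ; vertex = x ◂ vertex p
    ; increasing = ◂-increasing (λ i i< → <-≤-trans x<y (proj₁ (inside i i<))) increasing
    ; inside = ◂-all (λ v → x ≤ v × v < hi) (≤-refl , <-trans x<y y<hi)
                     (λ i i< → ≤-trans (<⇒≤ x<y) (proj₁ (inside i i<)) , proj₂ (inside i i<))
    ; edge⇒consecutive = edge⇒consecutive′ ; consecutive⇒edge = consecutive⇒edge′ }
    where
      open InducedPathIn p hiding (len; vertex)
      w : ℕ → ℕ
      w = x ◂ vertex p
      y<hi : y < hi
      y<hi = subst (_< hi) v₀≡y (proj₂ (inside 0 0<len))
      x-v₀ : Ad x (vertex p 0) ≡ true
      x-v₀ = subst (λ v → Ad x v ≡ true) (≡-sym v₀≡y) xy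
      x-edge : ∀ j → j < len p → Ad x (vertex p j) ≡ true → Consecutiveℕ 0 (suc j)
      x-edge zero    _  _ = inj₁ refl
      x-edge (suc j) j< e = contradiction (trans (≡-sym e) (x↛ _ y<vj (proj₂ (inside (suc j) j<)))) λ ()
        where y<vj = subst (_< vertex p (suc j)) v₀≡y (increasing 0 (suc j) z<s j<)
      edge⇒consecutive′ : ∀ i j → i < suc (len p) → j < suc (len p) → Ad (w i) (w j) ≡ true → Consecutiveℕ i j
      edge⇒consecutive′ zero    zero    _        _        e = contradiction (trans (≡-sym e) (Ad-irrefl x)) λ ()
      edge⇒consecutive′ zero    (suc j) _        (s≤s j<) e = x-edge j j< e
      edge⇒consecutive′ (suc i) zero    (s≤s i<) _        e = consecutive-sym (x-edge i i< (trans (Ad-sym x _) e))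
      edge⇒consecutive′ (suc i) (suc j) (s≤s i<) (s≤s j<) e = consecutive-suc (edge⇒consecutive i j i< j< e)
      consecutive⇒edge′ : ∀ i j → i < suc (len p) → j < suc (len p) → Consecutiveℕ i j → Ad (w i) (w j) ≡ true
      consecutive⇒edge′ zero    _       _        _        (inj₁ refl) = x-v₀
      consecutive⇒edge′ zero    _       _        _        (inj₂ ())
      consecutive⇒edge′ _       zero    _        _        (inj₁ ())
      consecutive⇒edge′ _       zero    _        _        (inj₂ refl) = trans (Ad-sym _ x) x-v₀
      consecutive⇒edge′ (suc i) (suc j) (s≤s i<) (s≤s j<) c = consecutive⇒edge i j i< j< (consecutive-pred c)

  data Occurs : NCM → ℕ → ℕ → Set where
    occ-nil  : ∀ {lo hi} → Occurs nil lo hi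
    occ-node : ∀ {A B lo hi} x y → lo ≤ x → suc x < y → y < hi → Ad x y ≡ true →
               Occurs A (suc x) y → Occurs B (suc y) hi → Occurs (node A B) lo hi

  occurs? : ∀ M lo hi → Dec (Occurs M lo hi)
  occurs? nil        lo hi = yes occ-nil
  occurs? (node A B) lo hi = map′
    (λ (x , _ , lo≤x , y , y<hi , x+1<y , xy , oA , oB) → occ-node x y lo≤x x+1<y y<hi xy oA oB)
    (λ { (occ-node x y lo≤x x+1<y y<hi xy oA oB) →
         x , <-trans (<-trans (n<1+n x) x+1<y) y<hi , lo≤x , y , y<hi , x+1<y , xy , oA , oB })
    (anyUpTo? (λ x → (lo ≤? x) ×-dec
      anyUpTo? (λ y → (suc x <? y) ×-dec (Ad x y ≟ᵇ true) ×-dec occurs? A (suc x) y ×-dec occurs? B (suc y) hi)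
               hi) hi)

  occurs-lower : ∀ {M lo lo′ hi} → lo′ ≤ lo → Occurs M lo hi → Occurs M lo′ hi
  occurs-lower _      occ-nil = occ-nil
  occurs-lower lo′≤lo (occ-node x y lo≤x x+1<y y<hi xy oA oB) =
    occ-node x y (≤-trans lo′≤lo lo≤x) x+1<y y<hi xy oA oB

  ¬occurs-empty : ∀ {A B lo} → ¬ Occurs (node A B) lo lo
  ¬occurs-empty (occ-node x y lo≤x x+1<y y<lo _ _ _) =
    <-irrefl refl (≤-<-trans lo≤x (<-trans (<-trans (n<1+n x) x+1<y) y<lo))

  furthestNeighbour : ∀ x hi → hi ≤ n → suc x < hi →
    Σ ℕ λ y → x < y × y < hi × Ad x y ≡ true × (∀ z → y < z → z < hi → Ad x z ≡ false)
  furthestNeighbour x (suc h) h<n x+1<h+1 with Ad x h in xh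
  ... | true  = h , s≤s⁻¹ x+1<h+1 , n<1+n h , xh , λ z h<z z≤h → contradiction (s≤s⁻¹ z≤h) (<⇒≱ h<z)
  ... | false with m≤n⇒m<n∨m≡n (s≤s⁻¹ x+1<h+1)
  ...   | inj₂ refl = contradiction (trans (≡-sym xh) (Ad-path x h<n)) λ ()
  ...   | inj₁ x+1<h with furthestNeighbour x h (≤-trans (n≤1+n h) h<n) x+1<h
  ...     | y , x<y , y<h , xy , x↛ = y , x<y , m<n⇒m<1+n y<h , xy , x↛′
    where
      x↛′ : ∀ z → y < z → z < suc h → Ad x z ≡ false
      x↛′ z y<z z<h+1 with m≤n⇒m<n∨m≡n (s≤s⁻¹ z<h+1)
      ... | inj₁ z<h = x↛ z y<z z<h
      ... | inj₂ refl = xh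

  module Greedy (A : NCM) (τ Γ : ℕ)
    (¬occursA⇒long-or-short : ∀ a b → a ≤ b → b ≤ n → ¬ Occurs A a b → LongPathIn τ a b ⊎ b ≤ a + Γ)
    {lo hi : ℕ} (hi≤n : hi ≤ n) (avoid : ¬ Occurs (node A nil) lo hi) where

    -- the gap under a jump x → y avoids A, else x y would close an occurrence of node A nil
    jump-bound : ∀ {x y} → lo ≤ x → x < y → y < hi → Ad x y ≡ true → LongPathIn τ lo hi ⊎ y ≤ x + suc Γ
    jump-bound {x} {y} lo≤x x<y y<hi xy with m≤n⇒m<n∨m≡n x<y
    ... | inj₂ refl = inj₂ (≤-trans (s≤s (m≤m+n x Γ)) (≤-reflexive (≡-sym (+-suc x Γ))))
    ... | inj₁ x+1<y
      with ¬occursA⇒long-or-short (suc x) y (<⇒≤ x+1<y) (≤-trans (<⇒≤ y<hi) hi≤n)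
             (λ oA → avoid (occ-node x y lo≤x x+1<y y<hi xy oA occ-nil))
    ...   | inj₁ (q , long) = inj₁ (widenPath (≤-trans lo≤x (n≤1+n x)) (<⇒≤ y<hi) q , long)
    ...   | inj₂ y≤ = inj₂ (≤-trans y≤ (≤-reflexive (≡-sym (+-suc x Γ))))

    GreedyPathFrom : ℕ → Set
    GreedyPathFrom x = Σ (InducedPathIn x hi) λ p → 0 < len p × vertex p 0 ≡ x × hi ≤ x + len p * suc Γ

    walk : ∀ fuel x → lo ≤ x → x < hi → hi ≤ x + fuel → LongPathIn τ lo hi ⊎ GreedyPathFrom x
    walk zero x _ x<hi hi≤x+0 = contradiction (≤-trans hi≤x+0 (≤-reflexive (+-identityʳ x))) (<⇒≱ x<hi)
    walk (suc fuel) x lo≤x x<hi hi≤ with m≤n⇒m<n∨m≡n x<hi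
    ... | inj₂ refl = inj₂ (singletonPath x ≤-refl ≤-refl , z<s , refl ,
                            ≤-trans (≤-reflexive (+-comm 1 x)) (+-monoʳ-≤ x (s≤s z≤n)))
    ... | inj₁ x+1<hi with furthestNeighbour x hi hi≤n x+1<hi
    ...   | y , x<y , y<hi , xy , x↛ with jump-bound lo≤x x<y y<hi xy
    ...     | inj₁ long = inj₁ long
    ...     | inj₂ y≤ with walk fuel y (≤-trans lo≤x (<⇒≤ x<y)) y<hi
                             (≤-trans hi≤ (≤-trans (≤-reflexive (+-suc x fuel)) (+-monoˡ-≤ fuel x<y)))
    ...       | inj₁ long = inj₁ long
    ...       | inj₂ (p , 0<len , v₀≡y , hi≤′) =
                inj₂ (prependPath x y p 0<len v₀≡y x<y xy x↛ , z<s , refl ,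
                      ≤-trans hi≤′ (≤-trans (+-monoˡ-≤ (len p * suc Γ) y≤)
                                            (≤-reflexive (+-assoc x (suc Γ) (len p * suc Γ)))))

    greedy : lo ≤ hi → LongPathIn τ lo hi ⊎ hi ≤ lo + τ * suc Γ
    greedy lo≤hi with m≤n⇒m<n∨m≡n lo≤hi
    ... | inj₂ refl = inj₂ (m≤m+n lo _)
    ... | inj₁ lo<hi with walk hi lo ≤-refl lo<hi (m≤n+m hi lo)
    ...   | inj₁ long = inj₁ long
    ...   | inj₂ (p , _ , _ , hi≤) with τ <? len p
    ...     | yes long  = inj₁ (p , long)
    ...     | no ¬long = inj₂ (≤-trans hi≤ (+-monoʳ-≤ lo (*-monoˡ-≤ (suc Γ) (≮⇒≥ ¬long))))

  ¬occurs⇒long-or-short : ∀ M τ {lo hi} → lo ≤ hi → hi ≤ n → ¬ Occurs M lo hi →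
                        LongPathIn τ lo hi ⊎ hi ≤ lo + size M * suc τ ^ depth M
  ¬occurs⇒long-or-short nil τ _ _ avoid = contradiction occ-nil avoid
  ¬occurs⇒long-or-short (node A B) τ {lo} {hi} lo≤hi hi≤n avoid
    with switchPoint (occurs? (node A nil) lo) hi lo≤hi ¬occurs-empty
  ... | p , lo≤p , p≤hi , prefix-avoids , switch
    with Greedy.greedy A τ (size A * suc τ ^ depth A) (λ _ _ → ¬occurs⇒long-or-short A τ)
                       (≤-trans p≤hi hi≤n) prefix-avoids lo≤p
  ... | inj₁ (q , long) = inj₁ (widenPath ≤-refl p≤hi q , long)
  ... | inj₂ p≤ with switch
  ...   | inj₁ refl =
          inj₂ (node-budget τ (size A) (size B) (depth A) (depth B) p≤ (≤-trans (n≤1+n p) (m≤m+n _ _)))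
  ...   | inj₂ (p<hi , occ-node x y lo≤x x+1<y y≤p xy oA occ-nil)
    with ¬occurs⇒long-or-short B τ p<hi hi≤n
           (λ oB → avoid (occ-node x y lo≤x x+1<y (≤-<-trans (s≤s⁻¹ y≤p) p<hi) xy oA (occurs-lower y≤p oB)))
  ...     | inj₁ (q , long) = inj₁ (widenPath (≤-trans lo≤p (n≤1+n p)) ≤-refl q , long)
  ...     | inj₂ hi≤ = inj₂ (node-budget τ (size A) (size B) (depth A) (depth B) p≤ hi≤)

  ¬occurs⇒inducedPath : ∀ M → ¬ Occurs M 0 n →
                        Σ (InducedPathIn 0 n) λ p → n ≤ size M * suc (len p) ^ depth M
  ¬occurs⇒inducedPath M avoid =
    climb len n len≤hi (λ τ → ¬occurs⇒long-or-short M τ z≤n ≤-refl avoid)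
          (λ τ≤τ′ n≤ → ≤-trans n≤ (*-monoʳ-≤ (size M) (^-monoˡ-≤ (depth M) (s≤s τ≤τ′))))
          n 0 emptyPath z≤n ≤-refl

  record Embedding (M : NCM) (lo hi : ℕ) : Set where
    field
      pos        : ℕ → ℕ
      inside     : ∀ i → i < size M → lo ≤ pos i × pos i < hi
      increasing : IncreasingBelow (size M) pos
      offPath    : ∀ i j → i < size M → j < size M → T (mAdj M i j) → OffPathEdge (pos i) (pos j)

  nilEmbedding : ∀ {lo hi} → Embedding nil lo hi
  nilEmbedding = record { pos = λ _ → 0 ; inside = λ _ () ; increasing = λ _ _ _ () ; offPath = λ _ _ () }

  nodeEmbedding : ∀ {A B lo hi} x y → lo ≤ x → suc x < y → y < hi → Ad x y ≡ true →
                  Embedding A (suc x) y → Embedding B (suc y) hi → Embedding (node A B) lo hi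
  nodeEmbedding {A} {B} {lo} {hi} x y lo≤x x+1<y y<hi xy eA eB = record
    { pos = pos
    ; inside = ◂-all Window (lo≤x , <-trans x<y y<hi)
                 (splice-all Window (size A) (λ i i< → widenA (EA.inside i i<))
                                             (≤-trans lo≤x (<⇒≤ x<y) , y<hi)
                                             (λ k k< → widenB (EB.inside k k<)))
    ; increasing = ◂-increasing
                     (splice-all (x <_) (size A) (λ i i< → proj₁ (EA.inside i i<)) x<y
                                                 (λ k k< → <-trans x<y (proj₁ (EB.inside k k<))))
                     (splice-increasing (size A) EA.increasing (λ i i< → proj₂ (EA.inside i i<))
                                                 (λ k k< → proj₁ (EB.inside k k<)) EB.increasing)
    ; offPath = offPath }
    where
      module EA = Embedding eA
      module EB = Embedding eB
      pos : ℕ → ℕ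
      pos = x ◂ splice (size A) EA.pos y EB.pos
      x<y : x < y
      x<y = <-trans (n<1+n x) x+1<y
      Window : ℕ → Set
      Window v = lo ≤ v × v < hi
      widenA : ∀ {v} → suc x ≤ v × v < y → Window v
      widenA (x<v , v<y) = ≤-trans lo≤x (<⇒≤ x<v) , <-trans v<y y<hi
      widenB : ∀ {v} → suc y ≤ v × v < hi → Window v
      widenB (y<v , v<hi) = ≤-trans lo≤x (<⇒≤ (<-trans x<y y<v)) , v<hi
      xy-offPath : OffPathEdge x y
      xy-offPath = xy , gap⇒¬consecutive x+1<y
      offPath : ∀ i j → i < size (node A B) → j < size (node A B) → T (mAdj (node A B) i j) →
                OffPathEdge (pos i) (pos j)
      offPath i j i< j< e with matchingEdge {A} {B} i j i< j< e
      ... | outer  = subst (OffPathEdge x) (≡-sym (splice-middle (size A))) xy-offPath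
      ... | outer′ = subst (λ v → OffPathEdge v x) (≡-sym (splice-middle (size A)))
                       (trans (Ad-sym y x) xy , gap⇒¬consecutive x+1<y ∘ consecutive-sym)
      ... | inner {i} {j} i<A j<A eA′ =
            subst₂ OffPathEdge (≡-sym (splice-left (size A) i<A)) (≡-sym (splice-left (size A) j<A))
                   (EA.offPath i j i<A j<A eA′)
      ... | after {k} {l} k<B l<B eB′ =
            subst₂ OffPathEdge (≡-sym (splice-right (size A) k)) (≡-sym (splice-right (size A) l))
                   (EB.offPath k l k<B l<B eB′)

  occurs⇒embedding : ∀ {M lo hi} → Occurs M lo hi → Embedding M lo hi
  occurs⇒embedding occ-nil = nilEmbedding
  occurs⇒embedding (occ-node x y lo≤x x+1<y y<hi xy oA oB) =
    nodeEmbedding x y lo≤x x+1<y y<hi xy (occurs⇒embedding oA) (occurs⇒embedding oB)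

module OnHamPath {n} (G : Graph n) (P : HamPath G) where

  -- adjacency between path positions; positions beyond the path have no neighbours
  adjAt : ℕ → ℕ → Bool
  adjAt x y with x <? n | y <? n
  ... | yes x<n | yes y<n = adj G (at P (fromℕ< x<n)) (at P (fromℕ< y<n))
  ... | _       | _       = false

  adjAt-toℕ : ∀ u v → adjAt (toℕ u) (toℕ v) ≡ adj G (at P u) (at P v)
  adjAt-toℕ u v with toℕ u <? n | toℕ v <? n
  ... | yes u<n | yes v<n = cong₂ (λ a b → adj G (at P a) (at P b)) (fromℕ<-toℕ u u<n) (fromℕ<-toℕ v v<n)
  ... | no u≮n  | _       = contradiction (toℕ<n u) u≮n
  ... | yes _   | no v≮n  = contradiction (toℕ<n v) v≮n

  adjAt-sym : ∀ x y → adjAt x y ≡ adjAt y x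
  adjAt-sym x y with x <? n | y <? n
  ... | yes _ | yes _ = Graph.sym G _ _
  ... | yes _ | no _  = refl
  ... | no _  | yes _ = refl
  ... | no _  | no _  = refl

  adjAt-irrefl : ∀ x → adjAt x x ≡ false
  adjAt-irrefl x with x <? n
  ... | yes _ = irref G _
  ... | no _  = refl

  adjAt-path : ∀ x → suc x < n → adjAt x (suc x) ≡ true
  adjAt-path x x+1<n with x <? n | suc x <? n
  ... | yes x<n | yes x+1<n′ =
        edges P (fromℕ< x<n) (fromℕ< x+1<n′)
              (trans (cong suc (toℕ-fromℕ< x<n)) (≡-sym (toℕ-fromℕ< x+1<n′)))
  ... | no x≮n  | _         = contradiction (<-trans (n<1+n x) x+1<n) x≮n
  ... | yes _   | no x+1≮n  = contradiction x+1<n x+1≮n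

  open PositionGraph n adjAt adjAt-sym adjAt-irrefl adjAt-path public

  embedding⇒contains : ∀ {k} {H : OrderedGraph k} {M} → Describes M H → Embedding M 0 n → Contains G P H
  embedding⇒contains {H = H} {M} (size≡k , describes) e = a , a-increasing , a-edges
    where
      open Embedding e
      u<size : ∀ u → toℕ u < size M
      u<size u = subst (toℕ u <_) (≡-sym size≡k) (toℕ<n u)
      a : Fin _ → Fin n
      a u = fromℕ< (proj₂ (inside (toℕ u) (u<size u)))
      toℕ-a : ∀ u → toℕ (a u) ≡ pos (toℕ u)
      toℕ-a u = toℕ-fromℕ< (proj₂ (inside (toℕ u) (u<size u)))
      a-increasing : StrictlyIncreasing a
      a-increasing i j i<j = subst₂ _<_ (≡-sym (toℕ-a i)) (≡-sym (toℕ-a j)) (increasing _ _ i<j (u<size j))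
      a-edges : ∀ i j → Edge H i j → EdgeOffPath G P (a i) (a j)
      a-edges i j ij with subst₂ OffPathEdge (≡-sym (toℕ-a i)) (≡-sym (toℕ-a j))
                            (offPath _ _ (u<size i) (u<size j) (from T-≡ (trans (≡-sym (describes i j)) ij)))
      ... | adjacent , ¬consecutive = trans (≡-sym (adjAt-toℕ (a i) (a j))) adjacent , ¬consecutive

  inducedPath⇒InducedPath : (p : InducedPathIn 0 n) → Σ (Fin (len p) → Fin n) (InducedPath G (len p))
  inducedPath⇒InducedPath p = at P ∘ f , injective′ , λ i j → edge⇒consecutive′ i j , consecutive⇒edge′ i j
    where
      open InducedPathIn p hiding (len; vertex)
      f : Fin (len p) → Fin n
      f i = fromℕ< (proj₂ (inside (toℕ i) (toℕ<n i)))
      toℕ-f : ∀ i → toℕ (f i) ≡ vertex p (toℕ i)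
      toℕ-f i = toℕ-fromℕ< (proj₂ (inside (toℕ i) (toℕ<n i)))
      injective′ : ∀ {i j} → at P (f i) ≡ at P (f j) → i ≡ j
      injective′ {i} {j} same with trans (≡-sym (toℕ-f i)) (trans (cong toℕ (injective P same)) (toℕ-f j))
      ... | vi≡vj with <-cmp (toℕ i) (toℕ j)
      ...   | tri< i<j _ _ = contradiction vi≡vj (<⇒≢ (increasing _ _ i<j (toℕ<n j)))
      ...   | tri≈ _ i≡j _ = toℕ-injective i≡j
      ...   | tri> _ _ j<i = contradiction (≡-sym vi≡vj) (<⇒≢ (increasing _ _ j<i (toℕ<n i)))
      adj≡adjAt : ∀ i j → adj G (at P (f i)) (at P (f j)) ≡ adjAt (vertex p (toℕ i)) (vertex p (toℕ j))
      adj≡adjAt i j = trans (≡-sym (adjAt-toℕ (f i) (f j))) (cong₂ adjAt (toℕ-f i) (toℕ-f j))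
      edge⇒consecutive′ : ∀ i j → Edge G (at P (f i)) (at P (f j)) → Consecutive i j
      edge⇒consecutive′ i j e = edge⇒consecutive _ _ (toℕ<n i) (toℕ<n j) (trans (≡-sym (adj≡adjAt i j)) e)
      consecutive⇒edge′ : ∀ i j → Consecutive i j → Edge G (at P (f i)) (at P (f j))
      consecutive⇒edge′ i j c = trans (adj≡adjAt i j) (consecutive⇒edge _ _ (toℕ<n i) (toℕ<n j) c)

  avoids⇒inducedPath : ∀ {k} (H : OrderedGraph k) M → Describes M H → Avoids G P H →
    Σ ℕ λ t → Σ (Fin t → Fin n) λ w → InducedPath G t w × n ≤ size M * suc t ^ depth M
  avoids⇒inducedPath H M describes avoids
    with ¬occurs⇒inducedPath M (λ o → avoids (embedding⇒contains {H = H} describes (occurs⇒embedding o)))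
  ... | p , n≤ = len p , proj₁ (inducedPath⇒InducedPath p) , proj₂ (inducedPath⇒InducedPath p) , n≤

theorem5 : ∀ {k} (H : OrderedGraph k) → 0 < k → IsPerfectMatching H → NonCrossing H →
    (M : NCM) → Describes M H →
    Σ ℕ λ K → Σ ℕ λ N → ∀ (n : ℕ) → N ≤ n →
      ∀ (G : Graph n) (P : HamPath G) → Avoids G P H →
        Σ ℕ λ t → Σ (Fin t → Fin n) λ w → InducedPath G t w × (n ≤ K * t ^ depth M)
-- The tree M alone carries the pattern; for k = 0 no (G, P) avoids H.
theorem5 H _ _ _ M describes = size M * 2 ^ depth M , suc (size M) , λ n s<n G P avoids →
  let (t , w , induced , n≤) = OnHamPath.avoids⇒inducedPath G P H M describes avoids
  in t , w , induced , n≤s*[1+t]^d⇒n≤s*2^d*t^d t (depth M) s<n n≤
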